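{- Let $\phi(x,y)$ be a quantifier-free formula with free variables $x,y$ over a finite relational vocabulary containing a binary relation symbol $R$, and let $d\ge 0$. Define $$\Psi:=\forall xy.\,\phi(x,y)\land \mathit{EssentialDAG}(R,d),\qquad \Psi':=\forall xy.\,\phi(x,y)\land\neg R(x,y).$$ Let the domain be $[n]$ and let $1\le m\le n$. If $\omega$ is an interpretation on $[n]$ with $\omega\models\Psi_{[m]}$, then $\omega\downarrow[m]\models\Psi'$ and $\omega\downarrow\{m+1,\dots,n\}\models\Psi$.
   Context: Interpretations are taken in Herbrand semantics: an interpretation on a finite domain is a truth assignment to all ground atoms. For $\Delta'\subseteq\Delta$, the interpretation $\omega\downarrow\Delta'$ is the interpretation on domain $\Delta'$ that agrees with $\omega$ on all ground atoms involving only elements of $\Delta'$. $\omega_R$ is the directed graph on the domain with an edge $c\to e$ iff $\omega\models R(c,e)$. A DAG is essential if every edge $a\to b$ is protected. An edge $a\to b$ is protected unless $\mathrm{pa}(b)=\mathrm{pa}(a)\cup\{a\}$, where $\mathrm{pa}$ denotes the set of parents. $\omega\models\mathit{EssentialDAG}(R,d)$ means that $\omega_R$ is an essential DAG with all indegrees at most $d$. $\omega\models\Psi_{[m]}$ means that $\omega\models\Psi$ and each of the elements $1,\dots,m$ is a sink of $\omega_R$, i.e. has outdegree $0$. -}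

module Defs where

open import Data.Nat using (ℕ; _≤_; _<_)
open import Data.Fin using (Fin; toℕ)
open import Data.Vec using (Vec; []; _∷_; map)
open import Data.Bool using (Bool; true)
open import Data.List using (List; length)
open import Data.List.Relation.Unary.All using (All)
open import Data.List.Relation.Unary.Unique.Propositional using (Unique)
open import Data.Product using (Σ; _×_; proj₁)
open import Data.Sum using (_⊎_)
open import Relation.Nullary using (¬_)
open import Relation.Binary.PropositionalEquality using (_≡_)

data Sym (k : ℕ) : Set where
  `R  : Sym k
  rel : Fin k → Sym k

arity : ∀ {k} → (Fin k → ℕ) → Sym k → ℕ
arity ar `R      = 2
arity ar (rel s) = ar s

-- Quantifier-free formulas in the two free variables x, y
-- (variables are Fin 2: zero = x, suc zero = y).  Equality atoms allowed.

data QF {k : ℕ} (ar : Fin k → ℕ) : Set where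
  atom : (s : Sym k) → Vec (Fin 2) (arity ar s) → QF ar
  eq   : Fin 2 → Fin 2 → QF ar
  neg  : QF ar → QF ar
  and  : QF ar → QF ar → QF ar
  or   : QF ar → QF ar → QF ar

Interp : ∀ {k} → (Fin k → ℕ) → Set → Set
Interp {k} ar D = (s : Sym k) → Vec D (arity ar s) → Bool

Sat : ∀ {k} {ar : Fin k → ℕ} {D : Set} → Interp ar D → (Fin 2 → D) → QF ar → Set
Sat ω ρ (atom s args) = ω s (map ρ args) ≡ true
Sat ω ρ (eq i j)      = ρ i ≡ ρ j
Sat ω ρ (neg φ)       = ¬ Sat ω ρ φ
Sat ω ρ (and φ ψ)     = Sat ω ρ φ × Sat ω ρ ψ
Sat ω ρ (or φ ψ)      = Sat ω ρ φ ⊎ Sat ω ρ ψ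

asg : {D : Set} → D → D → Fin 2 → D
asg a b Fin.zero    = a
asg a b (Fin.suc _) = b

SatAll : ∀ {k} {ar : Fin k → ℕ} {D : Set} → Interp ar D → QF ar → Set
SatAll {D = D} ω φ = (a b : D) → Sat ω (asg a b) φ

Edge : ∀ {k} {ar : Fin k → ℕ} {D : Set} → Interp ar D → D → D → Set
Edge ω c e = ω `R (c ∷ e ∷ []) ≡ true

data Path {D : Set} (E : D → D → Set) : D → D → Set where
  step : ∀ {a b} → E a b → Path E a b
  _∷ₚ_ : ∀ {a b c} → E a b → Path E b c → Path E a c

Acyclic : {D : Set} → (D → D → Set) → Set
Acyclic {D} E = (a : D) → ¬ Path E a a

InDegLe : {D : Set} → (D → D → Set) → ℕ → D → Set
InDegLe {D} E d b = (cs : List D) → Unique cs → All (λ c → E c b) cs → length cs ≤ d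

Protected : {D : Set} → (D → D → Set) → D → D → Set
Protected {D} E a b =
  ¬ ((c : D) → (E c b → (E c a ⊎ c ≡ a)) × ((E c a ⊎ c ≡ a) → E c b))

EssentialDAG : {D : Set} → (D → D → Set) → ℕ → Set
EssentialDAG {D} E d =
  Acyclic E × ((a b : D) → E a b → Protected E a b) × ((b : D) → InDegLe E d b)

SatΨ : ∀ {k} {ar : Fin k → ℕ} {D : Set} → QF ar → ℕ → Interp ar D → Set
SatΨ φ d ω = SatAll ω φ × EssentialDAG (Edge ω) d

SatΨ' : ∀ {k} {ar : Fin k → ℕ} {D : Set} → QF ar → Interp ar D → Set
SatΨ' {D = D} φ ω = (a b : D) → Sat ω (asg a b) φ × ¬ Edge ω a b

-- Elements 1..m of [n] (Fin indices 0..m-1) are sinks of ω_R.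
SinksUpTo : ∀ {k} {ar : Fin k → ℕ} {n : ℕ} → Interp ar (Fin n) → ℕ → Set
SinksUpTo {n = n} ω m = (i e : Fin n) → toℕ i < m → ¬ Edge ω i e

SatΨm : ∀ {k} {ar : Fin k → ℕ} {n : ℕ} → QF ar → ℕ → ℕ → Interp ar (Fin n) → Set
SatΨm φ d m ω = SatΨ φ d ω × SinksUpTo ω m

restrict : ∀ {k} {ar : Fin k → ℕ} {D : Set} → Interp ar D → (P : D → Set) → Interp ar (Σ D P)
restrict ω P s args = ω s (map proj₁ args)

-- [m] = {1..m}  (Fin indices < m);  {m+1..n}  (Fin indices ≥ m)
InFirst : {n : ℕ} → ℕ → Fin n → Set
InFirst m i = toℕ i < m

InRest : {n : ℕ} → ℕ → Fin n → Set
InRest m i = m ≤ toℕ i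

{-# OPTIONS --safe #-}
-- Quantifier-free truth only depends on the atomic facts about the assigned
-- elements, so ∀xy.φ passes to every substructure. Every element of [m] is a
-- sink, so ω↓[m] has no R-edges. Acyclicity and the indegree bound pass to any
-- induced subgraph. Protection of an edge a → b does not in general, but the
-- removed vertices are sinks: they are parents of neither a nor b, so
-- pa(b) = pa(a) ∪ {a} holds in ω↓{m+1,…,n} exactly when it holds in ω.
module Submission where

open import Defs
open import Data.Nat using (ℕ; _≤_; _≤?_)
open import Data.Nat.Properties using (≤-irrelevant; ≰⇒>)
open import Data.Fin using (Fin; toℕ)
open import Data.Vec using (Vec; map)
open import Data.Vec.Properties using (map-∘; map-cong)
import Data.List as List
open import Data.List.Properties using (length-map)
import Data.List.Relation.Unary.All.Properties as All
import Data.List.Relation.Unary.Unique.Propositional.Properties as Unique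
open import Data.Product using (Σ; ∃; _×_; _,_; proj₁; proj₂)
open import Data.Product.Function.NonDependent.Propositional using (_×-⇔_)
open import Data.Sum using (_⊎_; inj₁; inj₂; [_,_]; map₂)
open import Data.Sum.Function.Propositional using (_⊎-⇔_)
open import Function using (_∘_; _on_; _⇔_; mk⇔; Equivalence; Injective)
open import Function.Construct.Identity using (⇔-id)
open import Function.Related.TypeIsomorphisms using (¬-cong-⇔)
open import Relation.Nullary using (¬_; yes; no; contradiction)
open import Relation.Unary using (Irrelevant)
open import Relation.Binary.PropositionalEquality using (_≡_; _≗_; refl; sym; cong; subst)

open Equivalence using (to; from)

module _ {k} {ar : Fin k → ℕ} {D D′ : Set} {ω : Interp ar D} {ω′ : Interp ar D′}
         {ρ : Fin 2 → D} {ρ′ : Fin 2 → D′}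
         (same-atoms : ∀ s (args : Vec (Fin 2) (arity ar s)) →
                       ω s (map ρ args) ≡ ω′ s (map ρ′ args))
         (same-equalities : ∀ i j → (ρ i ≡ ρ j) ⇔ (ρ′ i ≡ ρ′ j)) where

  Sat-⇔ : (φ : QF ar) → Sat ω ρ φ ⇔ Sat ω′ ρ′ φ
  Sat-⇔ (atom s args) rewrite same-atoms s args = ⇔-id _
  Sat-⇔ (eq i j)      = same-equalities i j
  Sat-⇔ (neg φ)       = ¬-cong-⇔ (Sat-⇔ φ)
  Sat-⇔ (and φ ψ)     = Sat-⇔ φ ×-⇔ Sat-⇔ ψ
  Sat-⇔ (or φ ψ)      = Sat-⇔ φ ⊎-⇔ Sat-⇔ ψ

module _ {k} {ar : Fin k → ℕ} {D : Set} (ω : Interp ar D) where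

  Sat-≗ : {ρ σ : Fin 2 → D} → ρ ≗ σ → (φ : QF ar) → Sat ω ρ φ ⇔ Sat ω σ φ
  Sat-≗ {ρ} {σ} ρ≗σ = Sat-⇔ same-atoms same-equalities
    where
    same-atoms : ∀ s args → ω s (map ρ args) ≡ ω s (map σ args)
    same-atoms s args = cong (ω s) (map-cong ρ≗σ args)

    same-equalities : ∀ i j → (ρ i ≡ ρ j) ⇔ (σ i ≡ σ j)
    same-equalities i j rewrite ρ≗σ i | ρ≗σ j = ⇔-id _

  module _ {P : D → Set} (P-irrelevant : Irrelevant P) where

    proj₁-injective : Injective _≡_ _≡_ (proj₁ {B = P})
    proj₁-injective {x , p} {.x , q} refl = cong (x ,_) (P-irrelevant p q)

    Sat-restrict : (ρ : Fin 2 → Σ D P) (φ : QF ar) →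
                   Sat (restrict ω P) ρ φ ⇔ Sat ω (proj₁ ∘ ρ) φ
    Sat-restrict ρ = Sat-⇔ same-atoms same-equalities
      where
      same-atoms : ∀ s args → ω s (map proj₁ (map ρ args)) ≡ ω s (map (proj₁ ∘ ρ) args)
      same-atoms s args = cong (ω s) (sym (map-∘ proj₁ ρ args))

      same-equalities : ∀ i j → (ρ i ≡ ρ j) ⇔ (proj₁ (ρ i) ≡ proj₁ (ρ j))
      same-equalities i j = mk⇔ (cong proj₁) proj₁-injective

    SatAll-restrict : (φ : QF ar) → SatAll ω φ → SatAll (restrict ω P) φ
    SatAll-restrict φ holds a b =
      from (Sat-restrict (asg a b) φ) (to (Sat-≗ asg-proj₁ φ) (holds (proj₁ a) (proj₁ b)))
      where
      asg-proj₁ : asg (proj₁ a) (proj₁ b) ≗ proj₁ ∘ asg a b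
      asg-proj₁ Fin.zero    = refl
      asg-proj₁ (Fin.suc _) = refl

Sink : {D : Set} → (D → D → Set) → D → Set
Sink E c = ∀ e → ¬ E c e

-- pa(b) = pa(a) ∪ {a}, Chickering's covered edge; Protected E a b is ¬ Covered E a b.
Covered : {D : Set} → (D → D → Set) → D → D → Set
Covered {D} E a b = (c : D) → (E c b → (E c a ⊎ c ≡ a)) × ((E c a ⊎ c ≡ a) → E c b)

module _ {D D′ : Set} {E : D → D → Set} {f : D′ → D} where

  Path-on : ∀ {a b} → Path (E on f) a b → Path E (f a) (f b)
  Path-on (step e)  = step e
  Path-on (e ∷ₚ p) = e ∷ₚ Path-on p

  Acyclic-on : Acyclic E → Acyclic (E on f)
  Acyclic-on acyclic a = acyclic (f a) ∘ Path-on

  module _ (f-injective : Injective _≡_ _≡_ f) where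

    InDegLe-on : ∀ {d b} → InDegLe E d (f b) → InDegLe (E on f) d b
    InDegLe-on {d} indeg cs unique parents =
      subst (_≤ d) (length-map f cs)
        (indeg (List.map f cs) (Unique.map⁺ f-injective unique) (All.map⁺ parents))

    module _ (non-sinks-in-image : ∀ c → (∃ λ c′ → f c′ ≡ c) ⊎ Sink E c) where

      Covered-on : ∀ {a b} → E (f a) (f b) → Covered (E on f) a b → Covered E (f a) (f b)
      Covered-on {a} {b} a→b covered c with non-sinks-in-image c
      ... | inj₁ (c′ , refl) =
        map₂ (cong f) ∘ proj₁ (covered c′) , proj₂ (covered c′) ∘ map₂ f-injective
      ... | inj₂ c-sink =
        (λ c→b → contradiction c→b (c-sink (f b)))
        , [ (λ c→a → contradiction c→a (c-sink (f a))) , (λ { refl → a→b }) ]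

      EssentialDAG-on : ∀ {d} → EssentialDAG E d → EssentialDAG (E on f) d
      EssentialDAG-on (acyclic , protected , indeg) =
        Acyclic-on acyclic
        , (λ a b a→b → protected (f a) (f b) a→b ∘ Covered-on a→b)
        , (λ b → InDegLe-on (indeg (f b)))

proposition3 : ∀ {k : ℕ} (ar : Fin k → ℕ) (φ : QF ar) (d n m : ℕ) →
    1 ≤ m → m ≤ n →
    (ω : Interp ar (Fin n)) → SatΨm φ d m ω →
    SatΨ' φ (restrict ω (InFirst m)) × SatΨ φ d (restrict ω (InRest m))
proposition3 ar φ d n m _ _ ω ((φ-holds , essential) , sinks) =
  (λ a b → SatAll-restrict ω ≤-irrelevant φ φ-holds a b , sinks (proj₁ a) (proj₁ b) (proj₂ a))
  , SatAll-restrict ω ≤-irrelevant φ φ-holds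
  , EssentialDAG-on (proj₁-injective ω ≤-irrelevant) rest-contains-non-sinks essential
  where
  rest-contains-non-sinks : ∀ c → (∃ λ (c′ : Σ (Fin n) (InRest m)) → proj₁ c′ ≡ c) ⊎ Sink (Edge ω) c
  rest-contains-non-sinks c with m ≤? toℕ c
  ... | yes m≤c = inj₁ ((c , m≤c) , refl)
  ... | no  m≰c = inj₂ (λ e → sinks c e (≰⇒> m≰c))
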